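{- Let $p$ be a prime, $n,r\in\mathbb{N}$, $f:\mathbb{F}_p^n\to\mathbb{F}_p^r$, and $m\in\mathbb{N}$ even with $m\le n/4$. Consider the Unpredictable Random Coefficients Test with parameter $m$, and let $\mathcal{D}^X$ be the distribution of its last query $y$ conditioned on the initial queries $X=(x_1,\dots,x_m)$. Then, except with probability at most $2/p^m$ over the choice of $X$, the distribution $\mathcal{D}^X$ is $\frac{1}{\binom{m}{m/2}(p-1)^{m/2}}$-flat.
   Context: Unpredictable Random Coefficients Test with parameter $m$: draw $x_1,\dots,x_m\in\mathbb{F}_p^n$ independently and uniformly and query $f(x_1),\dots,f(x_m)$; draw coefficients $\sigma_1,\dots,\sigma_m$ independently and uniformly from $\{1,\dots,p-1\}\subseteq\mathbb{F}_p$; let $S$ be a uniformly random subset of $[m]$ of size $m/2$; query $f(y)$ with $y=\sum_{j\in S}\sigma_jx_j$; accept iff $\sum_{j\in S}\sigma_jf(x_j)=f(y)$. A distribution is $\alpha$-flat if every element has probability at most $\alpha$. -}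

module Defs where

open import Data.Nat using (ℕ; zero; suc; _+_; _*_; _%_; _/_; _≤_; _≤?_; NonZero)
open import Data.Nat.DivMod using (_mod_)
open import Data.Nat.Combinatorics using (_C_)
open import Data.Fin using (Fin; toℕ; fromℕ<; _≟_)
open import Data.Bool using (Bool; true; false)
open import Data.Vec using (Vec; []; _∷_; zipWith; replicate)
open import Data.Vec.Properties using (≡-dec)
open import Data.List using (List; []; _∷_; length; filter; map; concatMap; allFin)
open import Data.List.Relation.Unary.All using (All; all?)
open import Relation.Nullary using (¬_; ¬?)
open import Relation.Binary.PropositionalEquality using (_≡_)

allVecs : ∀ {A : Set} → List A → (k : ℕ) → List (Vec A k)
allVecs xs zero    = [] ∷ []
allVecs xs (suc k) = concatMap (λ a → map (a ∷_) (allVecs xs k)) xs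

size : ∀ {m} → Vec Bool m → ℕ
size []           = 0
size (true ∷ s)   = suc (size s)
size (false ∷ s)  = size s

module Fp (p : ℕ) .{{_ : NonZero p}} where

  F : Set
  F = Fin p

  _+F_ : F → F → F
  a +F b = (toℕ a + toℕ b) mod p

  _*F_ : F → F → F
  a *F b = (toℕ a * toℕ b) mod p

  0F : F
  0F = 0 mod p

  Vn : ℕ → Set
  Vn n = Vec F n

  _+V_ : ∀ {n} → Vn n → Vn n → Vn n
  _+V_ = zipWith _+F_

  _·V_ : ∀ {n} → F → Vn n → Vn n
  c ·V v = Data.Vec.map (c *F_) v

  0V : ∀ {n} → Vn n
  0V = replicate _ 0F

  allPoints : (n : ℕ) → List (Vn n)
  allPoints n = allVecs (allFin p) n

  nonzeroCoeffs : List F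
  nonzeroCoeffs = filter (λ a → ¬? (a ≟ 0F)) (allFin p)

  combo : ∀ {n m} → Vec (Vn n) m → Vec F m → Vec Bool m → Vn n
  combo []       []      []          = 0V
  combo (x ∷ xs) (σ ∷ σs) (true ∷ s)  = (σ ·V x) +V combo xs σs s
  combo (x ∷ xs) (σ ∷ σs) (false ∷ s) = combo xs σs s

  -- The internal randomness of the test given X: (σ, S), uniform over
  -- σ ∈ {1..p-1}^m and S ⊆ [m] with |S| = m/2.
  Coins : ℕ → Set
  Coins m = Vec F m × Vec Bool m
    where open import Data.Product using (_×_)

  allCoins : (m : ℕ) → List (Coins m)
  allCoins m = concatMap (λ σ → map (σ ,_) halfSubsets) (allVecs nonzeroCoeffs m)
    where
      open import Data.Product using (_,_)
      halfSubsets : List (Vec Bool m)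
      halfSubsets = filter (λ s → size s Data.Nat.≟ (m / 2))
                           (allVecs (true ∷ false ∷ []) m)

  -- Unnormalised mass of y under D^X: number of coin outcomes producing y.
  -- Pr_{D^X}[y] = massD X y / length (allCoins m).
  massD : ∀ {n m} → Vec (Vn n) m → Vn n → ℕ
  massD {n} {m} X y =
    length (filter (λ c → ≡-dec _≟_ (combo X (proj₁ c) (proj₂ c)) y) (allCoins m))
    where open import Data.Product using (proj₁; proj₂)

  -- D^X is (a/b)-flat: every y has Pr[y] ≤ a/b, i.e.
  -- massD X y * b ≤ a * (total number of coin outcomes).
  Flat : ∀ {n m} → Vec (Vn n) m → ℕ → ℕ → Set
  Flat {n} {m} X a b =
    All (λ y → massD X y * b ≤ a * length (allCoins m)) (allPoints n)

  flat? : ∀ {n m} (X : Vec (Vn n) m) (a b : ℕ) → Relation.Nullary.Dec (Flat X a b)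
  flat? {n} X a b = all? (λ y → massD X y * b ≤? a * _) (allPoints n)

  allX : (n m : ℕ) → List (Vec (Vn n) m)
  allX n m = allVecs (allPoints n) m

  badCount : (n m a b : ℕ) → ℕ
  badCount n m a b = length (filter (λ X → ¬? (flat? X a b)) (allX n m))

-- Fix X = (x₁, …, xₘ). If the linear map c ↦ Σⱼ cⱼ xⱼ on 𝔽ₚᵐ is injective, then the last query
-- y = Σ_{j ∈ S} σⱼ xⱼ determines the coefficient vector with σⱼ at j ∈ S and 0 elsewhere; as every
-- σⱼ is nonzero this vector determines S and the σⱼ with j ∈ S, leaving only the (p − 1)^(m − m/2)
-- choices of the other σⱼ. Out of (p − 1)^m · C(m, m/2) equally likely coins, that is the claimed
-- flatness. Otherwise two distinct coefficient vectors c ≠ d collide on X, which for a fixed pair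
-- happens for at most a p^(−n) fraction of all X. A union bound over the p^(2m) pairs, with 3m ≤ n,
-- bounds the fraction of bad X by p^(−m), slightly better than the 2/p^m of the statement.

module Submission where

open import Defs
open import Data.Bool using (Bool; true; false)
import Data.Bool
open import Data.Fin using (Fin; toℕ)
import Data.Fin as Fin
open import Data.Fin.Properties using (toℕ-fromℕ<; toℕ-injective; toℕ<n)
open import Data.List
  using (List; []; _∷_; length; filter; map; concatMap; cartesianProductWith; cartesianProduct; _++_; allFin)
open import Data.List.Properties
  using (length-++; length-map; length-tabulate; length-filter; filter-++; filter-none; filter-some; filter-≐)
open import Data.List.Membership.Propositional using (_∈_)
open import Data.List.Membership.Propositional.Properties
  using (∈-cartesianProductWith⁺; ∈-cartesianProduct⁺; ∈-allFin)
open import Data.List.Relation.Unary.All using (All; []; _∷_)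
import Data.List.Relation.Unary.All as All
import Data.List.Relation.Unary.All.Properties as All
open import Data.List.Relation.Unary.Any using (Any; here; there; any?)
import Data.List.Relation.Unary.Any as Any
open import Data.List.Relation.Unary.Unique.Propositional using (Unique; []; _∷_)
import Data.List.Relation.Unary.Unique.Propositional.Properties as Unique
open import Data.Nat
  using (ℕ; zero; suc; _+_; _*_; _^_; _∸_; _/_; _%_; _<_; _≤_; ∣_-_∣; z≤n; s≤s; NonZero; >-nonZero⁻¹)
import Data.Nat as ℕ
open import Data.Nat.Combinatorics using (_C_; nCk+nC[k+1]≡[n+1]C[k+1])
open import Data.Nat.DivMod using (m/n≤m; m≡m%n+[m/n]*n; %-distribˡ-+; m%n%n≡m%n; m<n⇒m%n≡m)
open import Data.Nat.Divisibility using (_∣_; divides; >⇒∤)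
open import Data.Nat.Primality using (Prime; prime⇒nonZero; euclidsLemma)
open import Data.Nat.Properties
open import Algebra.Properties.CommutativeSemigroup +-commutativeSemigroup
  using () renaming (x∙yz≈y∙xz to m+[n+o]≡n+[m+o])
open import Algebra.Properties.CommutativeSemigroup *-commutativeSemigroup
  using () renaming (x∙yz≈y∙xz to m*[n*o]≡n*[m*o])
open import Data.Nat.Tactic.RingSolver using (solve-∀)
open import Data.Product using (_×_; _,_; proj₁; proj₂)
open import Data.Sum using (inj₁; inj₂; [_,_]′)
open import Data.Vec using (Vec; []; _∷_)
open import Data.Vec.Properties using (∷-injective; ≡-dec)
import Data.Vec.Relation.Unary.All as Vec
open import Function using (_∘_; id)
open import Function.Definitions using (Injective)
open import Relation.Binary.Definitions using (DecidableEquality)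
open import Relation.Binary.PropositionalEquality
open import Relation.Nullary using (¬_; ¬?; Dec; yes; no; contradiction)
open import Relation.Nullary.Decidable using (isNo; _×-dec_)
open import Relation.Unary using (Decidable)

private variable
  A B D : Set

-- Counting and summing over lists

count : {P : A → Set} → Decidable P → List A → ℕ
count P? xs = length (filter P? xs)

∑ : List A → (A → ℕ) → ℕ
∑ []       f = 0
∑ (x ∷ xs) f = f x + ∑ xs f

syntax ∑ xs (λ x → e) = ∑[ x ← xs ] e

∑-mono-≤ : {f g : A → ℕ} (xs : List A) → (∀ x → f x ≤ g x) → ∑ xs f ≤ ∑ xs g
∑-mono-≤ []       f≤g = z≤n
∑-mono-≤ (x ∷ xs) f≤g = +-mono-≤ (f≤g x) (∑-mono-≤ xs f≤g)

∑-const : (xs : List A) (k : ℕ) → ∑[ _ ← xs ] k ≡ length xs * k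
∑-const []       k = refl
∑-const (x ∷ xs) k = cong (k +_) (∑-const xs k)

∑-*ʳ : (xs : List A) (f : A → ℕ) (k : ℕ) → (∑[ x ← xs ] f x) * k ≡ ∑[ x ← xs ] (f x * k)
∑-*ʳ []       f k = refl
∑-*ʳ (x ∷ xs) f k = trans (*-distribʳ-+ k (f x) _) (cong (f x * k +_) (∑-*ʳ xs f k))

module _ {P : A → Set} (P? : Decidable P) where

  count-++ : (xs ys : List A) → count P? (xs ++ ys) ≡ count P? xs + count P? ys
  count-++ xs ys = trans (cong length (filter-++ P? xs ys)) (length-++ (filter P? xs))

  count-map : (f : B → A) (xs : List B) → count P? (map f xs) ≡ count (λ x → P? (f x)) xs
  count-map f []       = refl
  count-map f (x ∷ xs) with P? (f x)
  ... | yes _ = cong suc (count-map f xs)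
  ... | no  _ = count-map f xs

  count-none : {xs : List A} → All (λ x → ¬ P x) xs → count P? xs ≡ 0
  count-none ¬Pxs = cong length (filter-none P? ¬Pxs)

  count-complement : (xs : List A) → count P? xs + count (λ x → ¬? (P? x)) xs ≡ length xs
  count-complement []       = refl
  count-complement (x ∷ xs) with P? x
  ... | yes _ = cong suc (count-complement xs)
  ... | no  _ = trans (+-suc _ _) (cong suc (count-complement xs))

  count≤1 : ∀ {xs} → Unique xs → (∀ {x y} → P x → P y → x ≡ y) → count P? xs ≤ 1
  count≤1 {[]}     _          _        = z≤n
  count≤1 {x ∷ xs} (x∉xs ∷ u) P-unique with P? x
  ... | yes Px = s≤s (≤-reflexive (count-none (All.map (λ x≢y Py → x≢y (P-unique Px Py)) x∉xs)))
  ... | no  _  = count≤1 u P-unique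

count-≟≤1 : (_≟_ : DecidableEquality A) {xs : List A} → Unique xs → ∀ z → count (_≟ z) xs ≤ 1
count-≟≤1 _≟_ uxs z = count≤1 (_≟ z) uxs (λ e e′ → trans e (sym e′))

count-mono : {P Q : A → Set} (P? : Decidable P) (Q? : Decidable Q) →
             (∀ {x} → P x → Q x) → ∀ xs → count P? xs ≤ count Q? xs
count-mono P? Q? P⇒Q []       = z≤n
count-mono P? Q? P⇒Q (x ∷ xs) with P? x | Q? x
... | yes _  | yes _  = s≤s (count-mono P? Q? P⇒Q xs)
... | yes Px | no ¬Qx = contradiction (P⇒Q Px) ¬Qx
... | no _   | yes _  = m≤n⇒m≤1+n (count-mono P? Q? P⇒Q xs)
... | no _   | no _   = count-mono P? Q? P⇒Q xs

count-≤-fibre : {P : A → Set} (P? : Decidable P) {g : A → B} (_≟_ : DecidableEquality B) →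
                (∀ {x x′} → P x → P x′ → g x ≡ g x′) →
                ∀ xs {k} → (∀ z → count (λ x → g x ≟ z) xs ≤ k) → count P? xs ≤ k
count-≤-fibre P? {g} _≟_ g-const xs fibre≤k with any? P? xs
... | no ¬any = ≤-trans (≤-reflexive (count-none P? (All.¬Any⇒All¬ xs ¬any))) z≤n
... | yes any with Any.satisfied any
...   | x₀ , Px₀ =
  ≤-trans (count-mono P? (λ x → g x ≟ g x₀) (λ Px → g-const Px Px₀) xs) (fibre≤k (g x₀))

private
  +-exchange : ∀ a c {b d} → b ≡ c + d → a + b ≡ c + (a + d)
  +-exchange a c {d = d} b≡c+d = trans (cong (a +_) b≡c+d) (m+[n+o]≡n+[m+o] a c d)

∑-count-∷ : {R : B → A → Set} (R? : ∀ y → Decidable (R y)) (x : A) (xs : List A) (ys : List B) →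
            ∑[ y ← ys ] count (R? y) (x ∷ xs) ≡ count (λ y → R? y x) ys + ∑[ y ← ys ] count (R? y) xs
∑-count-∷ R? x xs []       = refl
∑-count-∷ R? x xs (y ∷ ys) with R? y x
... | yes _ = cong suc (+-exchange (count (R? y) xs) (count (λ y → R? y x) ys) (∑-count-∷ R? x xs ys))
... | no  _ = +-exchange (count (R? y) xs) (count (λ y → R? y x) ys) (∑-count-∷ R? x xs ys)

∑-count-comm : {R : A → B → Set} (R? : ∀ x → Decidable (R x)) (xs : List A) (ys : List B) →
               ∑[ x ← xs ] count (R? x) ys ≡ ∑[ y ← ys ] count (λ x → R? x y) xs
∑-count-comm R? []       ys = sym (trans (∑-const ys 0) (*-zeroʳ (length ys)))
∑-count-comm R? (x ∷ xs) ys = begin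
  count (R? x) ys + ∑[ x′ ← xs ] count (R? x′) ys
    ≡⟨ cong (count (R? x) ys +_) (∑-count-comm R? xs ys) ⟩
  count (R? x) ys + ∑[ y ← ys ] count (λ x′ → R? x′ y) xs
    ≡⟨ ∑-count-∷ (λ y x′ → R? x′ y) x xs ys ⟨
  ∑[ y ← ys ] count (λ x′ → R? x′ y) (x ∷ xs) ∎
  where open ≡-Reasoning

union-bound : {P : A → Set} {R : B → A → Set} (P? : Decidable P) (R? : ∀ q → Decidable (R q)) →
              {qs : List B} → (∀ {x} → P x → Any (λ q → R q x) qs) →
              ∀ xs → count P? xs ≤ ∑[ q ← qs ] count (R? q) xs
union-bound P? R? {qs} covered []       = ≤-reflexive (sym (trans (∑-const qs 0) (*-zeroʳ (length qs))))
union-bound P? R? {qs} covered (x ∷ xs) = begin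
  count P? (x ∷ xs)                                                   ≤⟨ step ⟩
  count (λ q → R? q x) qs + ∑[ q ← qs ] count (R? q) xs                ≡⟨ ∑-count-∷ R? x xs qs ⟨
  ∑[ q ← qs ] count (R? q) (x ∷ xs)                                    ∎
  where
  open ≤-Reasoning
  step : count P? (x ∷ xs) ≤ count (λ q → R? q x) qs + ∑[ q ← qs ] count (R? q) xs
  step with P? x
  ... | yes Px = +-mono-≤ (filter-some (λ q → R? q x) (covered Px)) (union-bound P? R? covered xs)
  ... | no  _  = ≤-trans (union-bound P? R? covered xs) (m≤n+m _ _)

module _ {P : D → Set} (P? : Decidable P) (f : A → B → D) where

  count-cartesianProductWith : ∀ xs ys →
    count P? (cartesianProductWith f xs ys) ≡ ∑[ x ← xs ] count (λ y → P? (f x y)) ys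
  count-cartesianProductWith []       ys = refl
  count-cartesianProductWith (x ∷ xs) ys =
    trans (count-++ P? (map (f x) ys) _)
          (cong₂ _+_ (count-map P? (f x) ys) (count-cartesianProductWith xs ys))

  count-cartesianProductWith-≤ˡ : ∀ xs ys {k} → (∀ x → count (λ y → P? (f x y)) ys ≤ k) →
    count P? (cartesianProductWith f xs ys) ≤ length xs * k
  count-cartesianProductWith-≤ˡ xs ys {k} bound = begin
    count P? (cartesianProductWith f xs ys)       ≡⟨ count-cartesianProductWith xs ys ⟩
    ∑[ x ← xs ] count (λ y → P? (f x y)) ys       ≤⟨ ∑-mono-≤ xs bound ⟩
    ∑[ _ ← xs ] k                                 ≡⟨ ∑-const xs k ⟩
    length xs * k                                 ∎
    where open ≤-Reasoning

  count-cartesianProductWith-≤ʳ : ∀ xs ys {k} → (∀ y → count (λ x → P? (f x y)) xs ≤ k) →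
    count P? (cartesianProductWith f xs ys) ≤ length ys * k
  count-cartesianProductWith-≤ʳ xs ys {k} bound = begin
    count P? (cartesianProductWith f xs ys)       ≡⟨ count-cartesianProductWith xs ys ⟩
    ∑[ x ← xs ] count (λ y → P? (f x y)) ys       ≡⟨ ∑-count-comm (λ x y → P? (f x y)) xs ys ⟩
    ∑[ y ← ys ] count (λ x → P? (f x y)) xs       ≤⟨ ∑-mono-≤ ys bound ⟩
    ∑[ _ ← ys ] k                                 ≡⟨ ∑-const ys k ⟩
    length ys * k                                 ∎
    where open ≤-Reasoning

  count-cartesianProductWith-× : {Q : A → Set} {R : B → Set} (Q? : Decidable Q) (R? : Decidable R) → ∀ xs ys →
    (∀ {x y} → x ∈ xs → P (f x y) → Q x × R y) →
    count P? (cartesianProductWith f xs ys) ≤ count Q? xs * count R? ys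
  count-cartesianProductWith-× Q? R? []       ys split = z≤n
  count-cartesianProductWith-× Q? R? (x ∷ xs) ys split
    rewrite count-++ P? (map (f x) ys) (cartesianProductWith f xs ys) | count-map P? (f x) ys
    with Q? x
  ... | yes _  = +-mono-≤ (count-mono (λ y → P? (f x y)) R? (λ P → proj₂ (split (here refl) P)) ys)
                          (count-cartesianProductWith-× Q? R? xs ys (split ∘ there))
  ... | no ¬Qx
    rewrite count-none (λ y → P? (f x y)) (All.universal (λ _ P → ¬Qx (proj₁ (split (here refl) P))) ys) =
    count-cartesianProductWith-× Q? R? xs ys (split ∘ there)

-- Cartesian products and enumerated vectors

cartesianProductWith-via-concatMap : (f : A → B → D) (xs : List A) (ys : List B) →
  concatMap (λ x → map (f x) ys) xs ≡ cartesianProductWith f xs ys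
cartesianProductWith-via-concatMap f []       ys = refl
cartesianProductWith-via-concatMap f (x ∷ xs) ys = cong (map (f x) ys ++_) (cartesianProductWith-via-concatMap f xs ys)

length-cartesianProductWith : (f : A → B → D) (xs : List A) (ys : List B) →
  length (cartesianProductWith f xs ys) ≡ length xs * length ys
length-cartesianProductWith f []       ys = refl
length-cartesianProductWith f (x ∷ xs) ys =
  trans (length-++ (map (f x) ys)) (cong₂ _+_ (length-map (f x) ys) (length-cartesianProductWith f xs ys))

allVecs-suc : (xs : List A) (n : ℕ) → allVecs xs (suc n) ≡ cartesianProductWith _∷_ xs (allVecs xs n)
allVecs-suc xs n = cartesianProductWith-via-concatMap _∷_ xs (allVecs xs n)

length-allVecs : (xs : List A) (n : ℕ) → length (allVecs xs n) ≡ length xs ^ n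
length-allVecs xs zero    = refl
length-allVecs xs (suc n) = begin
  length (allVecs xs (suc n))                          ≡⟨ cong length (allVecs-suc xs n) ⟩
  length (cartesianProductWith _∷_ xs (allVecs xs n))  ≡⟨ length-cartesianProductWith _∷_ xs (allVecs xs n) ⟩
  length xs * length (allVecs xs n)                    ≡⟨ cong (length xs *_) (length-allVecs xs n) ⟩
  length xs * length xs ^ n                            ∎
  where open ≡-Reasoning

allVecs⁺ : {xs : List A} → Unique xs → ∀ n → Unique (allVecs xs n)
allVecs⁺ uxs zero    = [] ∷ []
allVecs⁺ {xs = xs} uxs (suc n) = subst Unique (sym (allVecs-suc xs n))
  (Unique.cartesianProductWith⁺ _∷_ ∷-injective uxs (allVecs⁺ uxs n))

∈-allVecs : {xs : List A} → (∀ a → a ∈ xs) → ∀ {n} (v : Vec A n) → v ∈ allVecs xs n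
∈-allVecs ∈xs []                  = here refl
∈-allVecs {xs = xs} ∈xs {suc n} (a ∷ v) = subst (a ∷ v ∈_) (sym (allVecs-suc xs n))
  (∈-cartesianProductWith⁺ _∷_ (∈xs a) (∈-allVecs ∈xs v))

All-allVecs : {P : A → Set} {xs : List A} → All P xs → ∀ n → All (Vec.All P) (allVecs xs n)
All-allVecs Pxs zero    = Vec.[] ∷ []
All-allVecs {xs = xs} Pxs (suc n) = subst (All (Vec.All _)) (sym (allVecs-suc xs n))
  (All.cartesianProductWith⁺ (setoid _) (setoid _) _∷_ xs (allVecs xs n)
    (λ a∈ v∈ → All.lookup Pxs a∈ Vec.∷ All.lookup (All-allVecs Pxs n) v∈))

size≤ : ∀ {m} (S : Vec Bool m) → size S ≤ m
size≤ []          = z≤n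
size≤ (true ∷ S)  = s≤s (size≤ S)
size≤ (false ∷ S) = m≤n⇒m≤1+n (size≤ S)

bits : List Bool
bits = true ∷ false ∷ []

bits-unique : Unique bits
bits-unique = ((λ ()) ∷ []) ∷ [] ∷ []

private
  count-size-suc : ∀ m k → count (λ S → size S ℕ.≟ k) (allVecs bits (suc m)) ≡
                   count (λ S → suc (size S) ℕ.≟ k) (allVecs bits m)
                   + count (λ S → size S ℕ.≟ k) (allVecs bits m)
  count-size-suc m k = begin
    count (λ S → size S ℕ.≟ k) (allVecs bits (suc m))
      ≡⟨ cong (count (λ S → size S ℕ.≟ k)) (allVecs-suc bits m) ⟩
    count (λ S → size S ℕ.≟ k) (cartesianProductWith _∷_ bits (allVecs bits m))
      ≡⟨ count-cartesianProductWith (λ S → size S ℕ.≟ k) _∷_ bits (allVecs bits m) ⟩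
    count (λ S → suc (size S) ℕ.≟ k) (allVecs bits m) + (count (λ S → size S ℕ.≟ k) (allVecs bits m) + 0)
      ≡⟨ cong (count (λ S → suc (size S) ℕ.≟ k) (allVecs bits m) +_) (+-identityʳ _) ⟩
    count (λ S → suc (size S) ℕ.≟ k) (allVecs bits m)
    + count (λ S → size S ℕ.≟ k) (allVecs bits m) ∎
    where open ≡-Reasoning

count-size : ∀ m k → count (λ S → size S ℕ.≟ k) (allVecs bits m) ≡ m C k
count-size zero    zero    = refl
count-size zero    (suc k) = refl
count-size (suc m) zero    = trans (count-size-suc m 0)
  (cong₂ _+_ (count-none (λ S → suc (size S) ℕ.≟ 0) (All.universal (λ _ ()) (allVecs bits m))) (count-size m 0))
count-size (suc m) (suc k) = trans (count-size-suc m (suc k)) (trans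
  (cong₂ _+_ (trans (cong length (filter-≐ _ _ (suc-injective , cong suc) (allVecs bits m))) (count-size m k))
             (count-size m (suc k)))
  (nCk+nC[k+1]≡[n+1]C[k+1] m k))

-- Arithmetic in ℕ

%≡%⇒∣∣-∣ : ∀ m n d .{{_ : NonZero d}} → m % d ≡ n % d → d ∣ ∣ m - n ∣
%≡%⇒∣∣-∣ m n d m%d≡n%d = divides ∣ m / d - n / d ∣ (begin
  ∣ m - n ∣                                   ≡⟨ cong₂ ∣_-_∣ (m≡m%n+[m/n]*n m d) (m≡m%n+[m/n]*n n d) ⟩
  ∣ m % d + m / d * d - n % d + n / d * d ∣   ≡⟨ cong (λ r → ∣ m % d + m / d * d - r + n / d * d ∣) m%d≡n%d ⟨
  ∣ m % d + m / d * d - m % d + n / d * d ∣   ≡⟨ ∣m+n-m+o∣≡∣n-o∣ (m % d) (m / d * d) (n / d * d) ⟩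
  ∣ m / d * d - n / d * d ∣                   ≡⟨ *-distribʳ-∣-∣ d (m / d) (n / d) ⟨
  ∣ m / d - n / d ∣ * d                       ∎)
  where open ≡-Reasoning

^-*-suc : ∀ x n m → x ^ (n * suc m) ≡ x ^ n * x ^ (n * m)
^-*-suc x n m = trans (cong (x ^_) (*-suc n m)) (^-distribˡ-+-* x n (n * m))

∣∧<⇒≡0 : ∀ {d k} → d ∣ k → k < d → k ≡ 0
∣∧<⇒≡0 {k = zero}  _   _   = refl
∣∧<⇒≡0 {k = suc k} d∣k k<d = contradiction d∣k (>⇒∤ k<d)

private
  ∣a*c+b*d-b*c+a*d∣≡∣a-b∣*∣c-d∣-≥ : ∀ {a b} c d → b ≤ a →
                                     ∣ a * c + b * d - b * c + a * d ∣ ≡ ∣ a - b ∣ * ∣ c - d ∣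
  ∣a*c+b*d-b*c+a*d∣≡∣a-b∣*∣c-d∣-≥ {a} {b} c d b≤a =
    subst (λ a → ∣ a * c + b * d - b * c + a * d ∣ ≡ ∣ a - b ∣ * ∣ c - d ∣) (m+[n∸m]≡n b≤a) (begin
      ∣ (b + e) * c + b * d - b * c + (b + e) * d ∣
        ≡⟨ cong₂ ∣_-_∣ (regroupˡ b e c d) (regroupʳ b e c d) ⟩
      ∣ (b * c + b * d) + e * c - (b * c + b * d) + e * d ∣
        ≡⟨ ∣m+n-m+o∣≡∣n-o∣ (b * c + b * d) (e * c) (e * d) ⟩
      ∣ e * c - e * d ∣
        ≡⟨ *-distribˡ-∣-∣ e c d ⟨
      e * ∣ c - d ∣
        ≡⟨ cong (_* ∣ c - d ∣) (trans (∣-∣-comm (b + e) b) (∣m-m+n∣≡n b e)) ⟨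
      ∣ b + e - b ∣ * ∣ c - d ∣ ∎)
    where
    open ≡-Reasoning
    e : ℕ
    e = a ∸ b
    regroupˡ : ∀ b e c d → (b + e) * c + b * d ≡ (b * c + b * d) + e * c
    regroupˡ = solve-∀
    regroupʳ : ∀ b e c d → b * c + (b + e) * d ≡ (b * c + b * d) + e * d
    regroupʳ = solve-∀

∣a*c+b*d-b*c+a*d∣≡∣a-b∣*∣c-d∣ : ∀ a b c d →
                                ∣ a * c + b * d - b * c + a * d ∣ ≡ ∣ a - b ∣ * ∣ c - d ∣
∣a*c+b*d-b*c+a*d∣≡∣a-b∣*∣c-d∣ a b c d with ≤-total b a
... | inj₁ b≤a = ∣a*c+b*d-b*c+a*d∣≡∣a-b∣*∣c-d∣-≥ c d b≤a
... | inj₂ a≤b = begin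
  ∣ a * c + b * d - b * c + a * d ∣   ≡⟨ ∣-∣-comm (a * c + b * d) (b * c + a * d) ⟩
  ∣ b * c + a * d - a * c + b * d ∣   ≡⟨ ∣a*c+b*d-b*c+a*d∣≡∣a-b∣*∣c-d∣-≥ c d a≤b ⟩
  ∣ b - a ∣ * ∣ c - d ∣               ≡⟨ cong (_* ∣ c - d ∣) (∣-∣-comm b a) ⟩
  ∣ a - b ∣ * ∣ c - d ∣               ∎
  where open ≡-Reasoning

-- The prime field

module _ (p : ℕ) (p-prime : Prime p) where

  instance
    p-nonZero : NonZero p
    p-nonZero = prime⇒nonZero p-prime

  open Fp p

  infix 4 _≟ᵛ_
  _≟ᵛ_ : ∀ {k} → DecidableEquality (Vec F k)
  _≟ᵛ_ = ≡-dec Fin._≟_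

  private
    infix 4 _≈_
    _≈_ : ℕ → ℕ → Set
    m ≈ n = m % p ≡ n % p

    ≈-+ : ∀ {m m′ n n′} → m ≈ m′ → n ≈ n′ → m + n ≈ m′ + n′
    ≈-+ {m} {m′} {n} {n′} m≈m′ n≈n′ =
      trans (%-distribˡ-+ m n p)
            (trans (cong₂ (λ a b → (a + b) % p) m≈m′ n≈n′) (sym (%-distribˡ-+ m′ n′ p)))

    toℕ-+F : ∀ a b → toℕ (a +F b) ≈ toℕ a + toℕ b
    toℕ-+F a b = trans (cong (_% p) (toℕ-fromℕ< _)) (m%n%n≡m%n _ p)

    toℕ-*F : ∀ a b → toℕ (a *F b) ≈ toℕ a * toℕ b
    toℕ-*F a b = trans (cong (_% p) (toℕ-fromℕ< _)) (m%n%n≡m%n _ p)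

    toℕ-0F : toℕ 0F ≡ 0
    toℕ-0F = trans (toℕ-fromℕ< _) (m<n⇒m%n≡m (>-nonZero⁻¹ p))

    toℕ-affine : ∀ a t u → toℕ ((a *F t) +F u) ≈ toℕ a * toℕ t + toℕ u
    toℕ-affine a t u = trans (toℕ-+F (a *F t) u) (≈-+ (toℕ-*F a t) refl)

    ∣∣-∣⇒≡ : ∀ {x y : F} → p ∣ ∣ toℕ x - toℕ y ∣ → x ≡ y
    ∣∣-∣⇒≡ {x} {y} p∣x-y = toℕ-injective (∣m-n∣≡0⇒m≡n (∣∧<⇒≡0 p∣x-y ∣x-y∣<p))
      where
      ∣x-y∣<p : ∣ toℕ x - toℕ y ∣ < p
      ∣x-y∣<p = ≤-<-trans (∣m-n∣≤m⊔n (toℕ x) (toℕ y)) (⊔-lub (toℕ<n x) (toℕ<n y))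

    ≈⇒≡ : ∀ {x y : F} → toℕ x ≈ toℕ y → x ≡ y
    ≈⇒≡ {x} {y} x≈y = ∣∣-∣⇒≡ (%≡%⇒∣∣-∣ (toℕ x) (toℕ y) p x≈y)

    -- Adding the congruences crosswise and cancelling u + v gives (a − b)(t − t′) ≡ 0 (mod p).
    ≈-cross : ∀ a b t t′ u v → a * t + u ≈ b * t + v → a * t′ + u ≈ b * t′ + v →
              p ∣ ∣ a - b ∣ * ∣ t - t′ ∣
    ≈-cross a b t t′ u v e e′ = subst (p ∣_) factorise (%≡%⇒∣∣-∣ _ _ p
      (subst₂ _≈_ (regroupˡ a b t t′ u v) (regroupʳ a b t t′ u v) (≈-+ e (sym e′))))
      where
      regroupˡ : ∀ a b t t′ u v → (a * t + u) + (b * t′ + v) ≡ (u + v) + (a * t + b * t′)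
      regroupˡ = solve-∀
      regroupʳ : ∀ a b t t′ u v → (b * t + v) + (a * t′ + u) ≡ (u + v) + (b * t + a * t′)
      regroupʳ = solve-∀
      factorise : ∣ (u + v) + (a * t + b * t′) - (u + v) + (b * t + a * t′) ∣ ≡ ∣ a - b ∣ * ∣ t - t′ ∣
      factorise = trans (∣m+n-m+o∣≡∣n-o∣ (u + v) _ _) (∣a*c+b*d-b*c+a*d∣≡∣a-b∣*∣c-d∣ a b t t′)

    affine-≡⇒≈ : ∀ {a b s u v} → (a *F s) +F u ≡ (b *F s) +F v →
                 toℕ a * toℕ s + toℕ u ≈ toℕ b * toℕ s + toℕ v
    affine-≡⇒≈ {a} {b} {s} {u} {v} e =
      trans (sym (toℕ-affine a s u)) (trans (cong (λ z → toℕ z % p) e) (toℕ-affine b s v))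

  +F-cancelˡ : ∀ {w u v} → w +F u ≡ w +F v → u ≡ v
  +F-cancelˡ {w} {u} {v} e = ∣∣-∣⇒≡ (subst (p ∣_) (∣m+n-m+o∣≡∣n-o∣ (toℕ w) (toℕ u) (toℕ v))
    (%≡%⇒∣∣-∣ _ _ p (trans (sym (toℕ-+F w u)) (trans (cong (λ z → toℕ z % p) e) (toℕ-+F w v)))))

  0*F+F : ∀ t r → (0F *F t) +F r ≡ r
  0*F+F t r = ≈⇒≡ (trans (toℕ-affine 0F t r) (cong (λ z → (z * toℕ t + toℕ r) % p) toℕ-0F))

  affine-unique : ∀ {a b t t′ u v} → a ≢ b →
                  (a *F t) +F u ≡ (b *F t) +F v → (a *F t′) +F u ≡ (b *F t′) +F v → t ≡ t′
  affine-unique {a} {b} {t} {t′} {u} {v} a≢b e e′ =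
    [ (λ p∣a-b → contradiction (∣∣-∣⇒≡ p∣a-b) a≢b) , ∣∣-∣⇒≡ ]′
    (euclidsLemma _ _ p-prime (≈-cross (toℕ a) (toℕ b) (toℕ t) (toℕ t′) (toℕ u) (toℕ v)
                                       (affine-≡⇒≈ {a} {b} {t} e) (affine-≡⇒≈ {a} {b} {t′} e′)))

  +V-cancelˡ : ∀ {n} {w u v : Vn n} → w +V u ≡ w +V v → u ≡ v
  +V-cancelˡ {w = []}    {[]}    {[]}    _ = refl
  +V-cancelˡ {w = _ ∷ _} {_ ∷ _} {_ ∷ _} e with ∷-injective e
  ... | e₀ , es = cong₂ _∷_ (+F-cancelˡ e₀) (+V-cancelˡ es)

  0·V+V : ∀ {n} (x r : Vn n) → (0F ·V x) +V r ≡ r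
  0·V+V []      []      = refl
  0·V+V (t ∷ x) (s ∷ r) = cong₂ _∷_ (0*F+F t s) (0·V+V x r)

  affine-uniqueV : ∀ {n a b} {x x′ u v : Vn n} → a ≢ b →
                   (a ·V x) +V u ≡ (b ·V x) +V v → (a ·V x′) +V u ≡ (b ·V x′) +V v → x ≡ x′
  affine-uniqueV {x = []}    {[]}    {[]}    {[]}    _   _ _  = refl
  affine-uniqueV {x = _ ∷ _} {_ ∷ _} {_ ∷ _} {_ ∷ _} a≢b e e′ with ∷-injective e | ∷-injective e′
  ... | e₀ , es | e₀′ , es′ = cong₂ _∷_ (affine-unique a≢b e₀ e₀′) (affine-uniqueV a≢b es es′)

  -- The distribution of the last query

  linComb : ∀ {n m} → Vec (Vn n) m → Vec F m → Vn n
  linComb []      []       = 0V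
  linComb (x ∷ X) (c ∷ cs) = (c ·V x) +V linComb X cs

  mask : ∀ {m} → Vec F m → Vec Bool m → Vec F m
  mask []      []          = []
  mask (a ∷ σ) (true ∷ S)  = a ∷ mask σ S
  mask (a ∷ σ) (false ∷ S) = 0F ∷ mask σ S

  combo≡linComb∘mask : ∀ {n m} (X : Vec (Vn n) m) σ S → combo X σ S ≡ linComb X (mask σ S)
  combo≡linComb∘mask []      []      []          = refl
  combo≡linComb∘mask (x ∷ X) (a ∷ σ) (true ∷ S)  = cong ((a ·V x) +V_) (combo≡linComb∘mask X σ S)
  combo≡linComb∘mask (x ∷ X) (a ∷ σ) (false ∷ S) = trans (combo≡linComb∘mask X σ S) (sym (0·V+V x _))

  support : ∀ {m} → Vec F m → Vec Bool m
  support []      = []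
  support (a ∷ c) = isNo (a Fin.≟ 0F) ∷ support c

  mask≡⇒support : ∀ {m} {σ c : Vec F m} {S} → Vec.All (_≢ 0F) σ → mask σ S ≡ c → S ≡ support c
  mask≡⇒support {σ = []}    {[]}     {[]}        Vec.[]       _ = refl
  mask≡⇒support {σ = a ∷ σ} {c₀ ∷ c} {true ∷ S}  (a≢0 Vec.∷ σ≢0) e with ∷-injective e
  ... | refl , e′ with a Fin.≟ 0F
  ...   | yes a≡0 = contradiction a≡0 a≢0
  ...   | no  _   = cong (true ∷_) (mask≡⇒support σ≢0 e′)
  mask≡⇒support {σ = a ∷ σ} {c₀ ∷ c} {false ∷ S} (_ Vec.∷ σ≢0)   e with ∷-injective e
  ... | refl , e′ with 0F Fin.≟ 0F
  ...   | yes _   = cong (false ∷_) (mask≡⇒support σ≢0 e′)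
  ...   | no  0≢0 = contradiction refl 0≢0

  nonzeroCoeffs-unique : Unique nonzeroCoeffs
  nonzeroCoeffs-unique = Unique.filter⁺ _ (Unique.allFin⁺ p)

  nonzeroCoeffs-≢0 : All (_≢ 0F) nonzeroCoeffs
  nonzeroCoeffs-≢0 = All.all-filter _ (allFin p)

  length-nonzeroCoeffs : length nonzeroCoeffs ≡ p ∸ 1
  length-nonzeroCoeffs = begin
    length nonzeroCoeffs                                      ≡⟨ m+n∸m≡n 1 _ ⟨
    1 + length nonzeroCoeffs ∸ 1                              ≡⟨ cong (λ k → k + length nonzeroCoeffs ∸ 1) one-zero ⟨
    count (Fin._≟ 0F) (allFin p) + length nonzeroCoeffs ∸ 1   ≡⟨ cong (_∸ 1) (count-complement (Fin._≟ 0F) (allFin p)) ⟩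
    length (allFin p) ∸ 1                                     ≡⟨ cong (_∸ 1) (length-tabulate {n = p} id) ⟩
    p ∸ 1                                                     ∎
    where
    open ≡-Reasoning
    one-zero : count (Fin._≟ 0F) (allFin p) ≡ 1
    one-zero = ≤-antisym (count-≟≤1 Fin._≟_ (Unique.allFin⁺ p) 0F)
                         (filter-some (Fin._≟ 0F) (Any.map sym (∈-allFin 0F)))

  count-mask≡-≤ : ∀ {m} (S : Vec Bool m) (c : Vec F m) →
                count (λ σ → mask σ S ≟ᵛ c) (allVecs nonzeroCoeffs m) ≤ (p ∸ 1) ^ (m ∸ size S)
  count-mask≡-≤ []          []       = length-filter (λ σ → mask σ [] ≟ᵛ []) (allVecs nonzeroCoeffs 0)
  count-mask≡-≤ {suc m} (true ∷ S) (c₀ ∷ c) = begin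
    count P? (allVecs nonzeroCoeffs (suc m))
      ≡⟨ cong (count P?) (allVecs-suc nonzeroCoeffs m) ⟩
    count P? (cartesianProductWith _∷_ nonzeroCoeffs (allVecs nonzeroCoeffs m))
      ≤⟨ count-cartesianProductWith-× P? _∷_ (Fin._≟ c₀) R? nonzeroCoeffs _ (λ _ → ∷-injective) ⟩
    count (Fin._≟ c₀) nonzeroCoeffs * count R? (allVecs nonzeroCoeffs m)
      ≤⟨ *-mono-≤ (count-≟≤1 Fin._≟_ nonzeroCoeffs-unique c₀) (count-mask≡-≤ S c) ⟩
    1 * (p ∸ 1) ^ (m ∸ size S)
      ≡⟨ *-identityˡ _ ⟩
    (p ∸ 1) ^ (m ∸ size S) ∎
    where
    open ≤-Reasoning
    P? : Decidable (λ σ → mask σ (true ∷ S) ≡ c₀ ∷ c)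
    P? σ = mask σ (true ∷ S) ≟ᵛ c₀ ∷ c
    R? : Decidable (λ σ → mask σ S ≡ c)
    R? σ = mask σ S ≟ᵛ c
  count-mask≡-≤ {suc m} (false ∷ S) (c₀ ∷ c) = begin
    count P? (allVecs nonzeroCoeffs (suc m))
      ≡⟨ cong (count P?) (allVecs-suc nonzeroCoeffs m) ⟩
    count P? (cartesianProductWith _∷_ nonzeroCoeffs (allVecs nonzeroCoeffs m))
      ≤⟨ count-cartesianProductWith-≤ˡ P? _∷_ nonzeroCoeffs _
           (λ a → ≤-trans (count-mono (λ σ → P? (a ∷ σ)) R? (proj₂ ∘ ∷-injective) (allVecs nonzeroCoeffs m))
                          (count-mask≡-≤ S c)) ⟩
    length nonzeroCoeffs * (p ∸ 1) ^ (m ∸ size S)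
      ≡⟨ cong (_* (p ∸ 1) ^ (m ∸ size S)) length-nonzeroCoeffs ⟩
    (p ∸ 1) ^ suc (m ∸ size S)
      ≡⟨ cong ((p ∸ 1) ^_) (+-∸-assoc 1 (size≤ S)) ⟨
    (p ∸ 1) ^ (suc m ∸ size S) ∎
    where
    open ≤-Reasoning
    P? : Decidable (λ σ → mask σ (false ∷ S) ≡ c₀ ∷ c)
    P? σ = mask σ (false ∷ S) ≟ᵛ c₀ ∷ c
    R? : Decidable (λ σ → mask σ S ≡ c)
    R? σ = mask σ S ≟ᵛ c

  halfSubsets : ∀ m → List (Vec Bool m)
  halfSubsets m = filter (λ S → size S ℕ.≟ (m / 2)) (allVecs bits m)

  halfSubsets-unique : ∀ m → Unique (halfSubsets m)
  halfSubsets-unique m = Unique.filter⁺ _ (allVecs⁺ bits-unique m)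

  allCoins≡ : ∀ m → allCoins m ≡ cartesianProductWith _,_ (allVecs nonzeroCoeffs m) (halfSubsets m)
  allCoins≡ m = cartesianProductWith-via-concatMap _,_ (allVecs nonzeroCoeffs m) (halfSubsets m)

  length-allCoins : ∀ m → length (allCoins m) ≡ (p ∸ 1) ^ m * (m C (m / 2))
  length-allCoins m = begin
    length (allCoins m)
      ≡⟨ cong length (allCoins≡ m) ⟩
    length (cartesianProductWith _,_ (allVecs nonzeroCoeffs m) (halfSubsets m))
      ≡⟨ length-cartesianProductWith _,_ (allVecs nonzeroCoeffs m) (halfSubsets m) ⟩
    length (allVecs nonzeroCoeffs m) * length (halfSubsets m)
      ≡⟨ cong₂ _*_ (trans (length-allVecs nonzeroCoeffs m) (cong (_^ m) length-nonzeroCoeffs)) (count-size m (m / 2)) ⟩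
    (p ∸ 1) ^ m * (m C (m / 2)) ∎
    where open ≡-Reasoning

  -- As σ has no zero entry, mask σ S ≡ c forces S ≡ support c: a single subset contributes,
  -- and only if support c has m / 2 elements.
  count-coins-mask≡-≤ : ∀ {m} (c : Vec F m) →
    count (λ σS → mask (proj₁ σS) (proj₂ σS) ≟ᵛ c) (allCoins m) ≤ (p ∸ 1) ^ (m ∸ m / 2)
  count-coins-mask≡-≤ {m} c = begin
    count P? (allCoins m)
      ≡⟨ cong (count P?) (allCoins≡ m) ⟩
    count P? (cartesianProductWith _,_ (allVecs nonzeroCoeffs m) (halfSubsets m))
      ≤⟨ count-cartesianProductWith-× P? _,_ Q? R? (allVecs nonzeroCoeffs m) (halfSubsets m) split ⟩
    count Q? (allVecs nonzeroCoeffs m) * count R? (halfSubsets m)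
      ≤⟨ *-monoˡ-≤ _ (count-mask≡-≤ s c) ⟩
    (p ∸ 1) ^ (m ∸ size s) * count R? (halfSubsets m)
      ≤⟨ at-most-one-half ⟩
    (p ∸ 1) ^ (m ∸ m / 2) ∎
    where
    open ≤-Reasoning
    s : Vec Bool m
    s = support c
    P? : Decidable (λ σS → mask (proj₁ σS) (proj₂ σS) ≡ c)
    P? σS = mask (proj₁ σS) (proj₂ σS) ≟ᵛ c
    Q? : Decidable (λ σ → mask σ s ≡ c)
    Q? σ = mask σ s ≟ᵛ c
    R? : Decidable (_≡ s)
    R? S = ≡-dec Data.Bool._≟_ S s
    split : ∀ {σ S} → σ ∈ allVecs nonzeroCoeffs m → mask σ S ≡ c → mask σ s ≡ c × S ≡ s
    split {σ} {S} σ∈ e = subst (λ S → mask σ S ≡ c) S≡s e , S≡s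
      where
      S≡s : S ≡ s
      S≡s = mask≡⇒support (All.lookup (All-allVecs nonzeroCoeffs-≢0 m) σ∈) e
    at-most-one-half : (p ∸ 1) ^ (m ∸ size s) * count R? (halfSubsets m) ≤ (p ∸ 1) ^ (m ∸ m / 2)
    at-most-one-half with size s ℕ.≟ m / 2
    ... | yes size≡ = begin
      (p ∸ 1) ^ (m ∸ size s) * count R? (halfSubsets m)
        ≤⟨ *-monoʳ-≤ ((p ∸ 1) ^ (m ∸ size s)) (count-≟≤1 (≡-dec Data.Bool._≟_) (halfSubsets-unique m) s) ⟩
      (p ∸ 1) ^ (m ∸ size s) * 1
        ≡⟨ *-identityʳ _ ⟩
      (p ∸ 1) ^ (m ∸ size s)
        ≡⟨ cong (λ k → (p ∸ 1) ^ (m ∸ k)) size≡ ⟩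
      (p ∸ 1) ^ (m ∸ m / 2) ∎
    ... | no  size≢ =
      ≤-trans (≤-reflexive (trans (cong ((p ∸ 1) ^ (m ∸ size s) *_) no-half) (*-zeroʳ ((p ∸ 1) ^ (m ∸ size s))))) z≤n
      where
      no-half : count R? (halfSubsets m) ≡ 0
      no-half = count-none R? (All.map (λ size≡ S≡s → size≢ (subst (λ S → size S ≡ m / 2) S≡s size≡))
                                       (All.all-filter _ (allVecs bits m)))

  flatDenominator : ℕ → ℕ
  flatDenominator m = (m C (m / 2)) * (p ∸ 1) ^ (m / 2)

  massD≤ : ∀ {n m} (X : Vec (Vn n) m) → Injective _≡_ _≡_ (linComb X) →
            ∀ y → massD X y ≤ (p ∸ 1) ^ (m ∸ m / 2)
  massD≤ {m = m} X inj y =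
    count-≤-fibre (λ σS → combo X (proj₁ σS) (proj₂ σS) ≟ᵛ y) _≟ᵛ_
                  same-mask (allCoins m) count-coins-mask≡-≤
    where
    same-mask : ∀ {σS σS′ : Coins m} →
                combo X (proj₁ σS) (proj₂ σS) ≡ y → combo X (proj₁ σS′) (proj₂ σS′) ≡ y →
                mask (proj₁ σS) (proj₂ σS) ≡ mask (proj₁ σS′) (proj₂ σS′)
    same-mask {σ , S} {σ′ , S′} e e′ =
      inj (trans (sym (combo≡linComb∘mask X σ S)) (trans (trans e (sym e′)) (combo≡linComb∘mask X σ′ S′)))

  injective⇒flat : ∀ {n m} (X : Vec (Vn n) m) → Injective _≡_ _≡_ (linComb X) →
                   Flat X 1 (flatDenominator m)
  injective⇒flat {n} {m} X inj = All.universal bound (allPoints n)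
    where
    k : ℕ
    k = m / 2
    bound : ∀ y → massD X y * ((m C k) * (p ∸ 1) ^ k) ≤ 1 * length (allCoins m)
    bound y = begin
      massD X y * ((m C k) * (p ∸ 1) ^ k)            ≤⟨ *-monoˡ-≤ _ (massD≤ X inj y) ⟩
      (p ∸ 1) ^ (m ∸ k) * ((m C k) * (p ∸ 1) ^ k)    ≡⟨ m*[n*o]≡n*[m*o] ((p ∸ 1) ^ (m ∸ k)) (m C k) _ ⟩
      (m C k) * ((p ∸ 1) ^ (m ∸ k) * (p ∸ 1) ^ k)    ≡⟨ cong ((m C k) *_) (^-distribˡ-+-* (p ∸ 1) (m ∸ k) k) ⟨
      (m C k) * (p ∸ 1) ^ (m ∸ k + k)                ≡⟨ cong (λ e → (m C k) * (p ∸ 1) ^ e) (m∸n+n≡m (m/n≤m m 2)) ⟩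
      (m C k) * (p ∸ 1) ^ m                          ≡⟨ *-comm (m C k) _ ⟩
      (p ∸ 1) ^ m * (m C k)                          ≡⟨ length-allCoins m ⟨
      length (allCoins m)                            ≡⟨ *-identityˡ _ ⟨
      1 * length (allCoins m)                        ∎
      where open ≤-Reasoning

  -- Collisions of linear combinations

  length-allPoints : ∀ n → length (allPoints n) ≡ p ^ n
  length-allPoints n = trans (length-allVecs (allFin p) n) (cong (_^ n) (length-tabulate {n = p} id))

  length-allX : ∀ n m → length (allX n m) ≡ p ^ (n * m)
  length-allX n m = trans (length-allVecs (allPoints n) m) (trans (cong (_^ m) (length-allPoints n)) (^-*-assoc p n m))

  -- Peel off x₁: if a ≡ b the first terms cancel; otherwise, for each choice of the other points,
  -- a x₁ + u ≡ b x₁ + v has at most one solution x₁.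
  count-linComb≡ : ∀ n m {c d : Vec F m} → c ≢ d →
    count (λ X → linComb X c ≟ᵛ linComb X d) (allX n m) * p ^ n ≤ p ^ (n * m)
  count-linComb≡ n zero    {[]}    {[]}    c≢d = contradiction refl c≢d
  count-linComb≡ n (suc m) {a ∷ c} {b ∷ d} c≢d with a Fin.≟ b
  ... | yes refl = begin
    count P? (allX n (suc m)) * p ^ n
      ≡⟨ cong (λ Xs → count P? Xs * p ^ n) (allVecs-suc (allPoints n) m) ⟩
    count P? (cartesianProductWith _∷_ (allPoints n) (allX n m)) * p ^ n
      ≤⟨ *-monoˡ-≤ (p ^ n) (count-cartesianProductWith-≤ˡ P? _∷_ (allPoints n) (allX n m)
                               (λ x → count-mono (λ X → P? (x ∷ X)) R? +V-cancelˡ (allX n m))) ⟩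
    length (allPoints n) * count R? (allX n m) * p ^ n
      ≡⟨ cong (λ k → k * count R? (allX n m) * p ^ n) (length-allPoints n) ⟩
    p ^ n * count R? (allX n m) * p ^ n
      ≡⟨ *-assoc (p ^ n) _ (p ^ n) ⟩
    p ^ n * (count R? (allX n m) * p ^ n)
      ≤⟨ *-monoʳ-≤ (p ^ n) (count-linComb≡ n m (c≢d ∘ cong (a ∷_))) ⟩
    p ^ n * p ^ (n * m)
      ≡⟨ ^-*-suc p n m ⟨
    p ^ (n * suc m) ∎
    where
    open ≤-Reasoning
    P? : Decidable (λ X → linComb X (a ∷ c) ≡ linComb X (a ∷ d))
    P? X = linComb X (a ∷ c) ≟ᵛ linComb X (a ∷ d)
    R? : Decidable (λ X → linComb X c ≡ linComb X d)
    R? X = linComb X c ≟ᵛ linComb X d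
  ... | no a≢b = begin
    count P? (allX n (suc m)) * p ^ n
      ≡⟨ cong (λ Xs → count P? Xs * p ^ n) (allVecs-suc (allPoints n) m) ⟩
    count P? (cartesianProductWith _∷_ (allPoints n) (allX n m)) * p ^ n
      ≤⟨ *-monoˡ-≤ (p ^ n) (count-cartesianProductWith-≤ʳ P? _∷_ (allPoints n) (allX n m)
                               (λ X → count≤1 (λ x → P? (x ∷ X)) (allVecs⁺ (Unique.allFin⁺ p) n) (affine-uniqueV a≢b))) ⟩
    length (allX n m) * 1 * p ^ n
      ≡⟨ cong (_* p ^ n) (trans (*-identityʳ _) (length-allX n m)) ⟩
    p ^ (n * m) * p ^ n
      ≡⟨ trans (^-*-suc p n m) (*-comm (p ^ n) _) ⟨
    p ^ (n * suc m) ∎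
    where
    open ≤-Reasoning
    P? : Decidable (λ X → linComb X (a ∷ c) ≡ linComb X (b ∷ d))
    P? X = linComb X (a ∷ c) ≟ᵛ linComb X (b ∷ d)

  coefficientPairs : ∀ m → List (Vec F m × Vec F m)
  coefficientPairs m = cartesianProduct (allVecs (allFin p) m) (allVecs (allFin p) m)

  length-coefficientPairs : ∀ m → length (coefficientPairs m) ≡ p ^ m * p ^ m
  length-coefficientPairs m = trans (length-cartesianProductWith _,_ (allVecs (allFin p) m) (allVecs (allFin p) m))
                                    (cong₂ _*_ (length-allPoints m) (length-allPoints m))

  Collision : ∀ {n m} → Vec F m × Vec F m → Vec (Vn n) m → Set
  Collision (c , d) X = c ≢ d × linComb X c ≡ linComb X d

  collision? : ∀ {n m} (cd : Vec F m × Vec F m) → Decidable (Collision {n} cd)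
  collision? (c , d) X = ¬? (c ≟ᵛ d) ×-dec linComb X c ≟ᵛ linComb X d

  count-collision : ∀ n m (cd : Vec F m × Vec F m) → count (collision? cd) (allX n m) * p ^ n ≤ p ^ (n * m)
  count-collision n m (c , d) = by-cases (c ≟ᵛ d)
    where
    by-cases : Dec (c ≡ d) → count (collision? (c , d)) (allX n m) * p ^ n ≤ p ^ (n * m)
    by-cases (yes c≡d) = ≤-trans (≤-reflexive (cong (_* p ^ n) no-collision)) z≤n
      where
      no-collision : count (collision? (c , d)) (allX n m) ≡ 0
      no-collision = count-none (collision? (c , d)) (All.universal (λ _ coll → proj₁ coll c≡d) (allX n m))
    by-cases (no c≢d) = ≤-trans (*-monoˡ-≤ (p ^ n) (count-mono (collision? (c , d)) _ proj₂ (allX n m)))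
                                (count-linComb≡ n m c≢d)

  nonFlat⇒collision : ∀ {n m} (X : Vec (Vn n) m) → ¬ Flat X 1 (flatDenominator m) →
                      Any (λ cd → Collision cd X) (coefficientPairs m)
  nonFlat⇒collision {m = m} X ¬flat with any? (λ cd → collision? cd X) (coefficientPairs m)
  ... | yes collision = collision
  ... | no ¬collision = contradiction (injective⇒flat X injective) ¬flat
    where
    injective : Injective _≡_ _≡_ (linComb X)
    injective {c} {d} e with c ≟ᵛ d
    ... | yes c≡d = c≡d
    ... | no  c≢d = contradiction (Any.map (λ { refl → c≢d , e })
                                           (∈-cartesianProduct⁺ (∈-allVecs ∈-allFin c) (∈-allVecs ∈-allFin d)))
                                  ¬collision

  badCount*p^n≤-union : ∀ n m → badCount n m 1 (flatDenominator m) * p ^ n ≤ p ^ m * p ^ m * p ^ (n * m)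
  badCount*p^n≤-union n m = begin
    count nonFlat? (allX n m) * p ^ n
      ≤⟨ *-monoˡ-≤ (p ^ n) (union-bound nonFlat? collision? (λ {X} → nonFlat⇒collision X) (allX n m)) ⟩
    (∑[ cd ← coefficientPairs m ] count (collision? cd) (allX n m)) * p ^ n
      ≡⟨ ∑-*ʳ (coefficientPairs m) (λ cd → count (collision? cd) (allX n m)) (p ^ n) ⟩
    ∑[ cd ← coefficientPairs m ] (count (collision? cd) (allX n m) * p ^ n)
      ≤⟨ ∑-mono-≤ (coefficientPairs m) (count-collision n m) ⟩
    ∑[ _ ← coefficientPairs m ] (p ^ (n * m))
      ≡⟨ ∑-const (coefficientPairs m) (p ^ (n * m)) ⟩
    length (coefficientPairs m) * p ^ (n * m)
      ≡⟨ cong (_* p ^ (n * m)) (length-coefficientPairs m) ⟩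
    p ^ m * p ^ m * p ^ (n * m) ∎
    where
    open ≤-Reasoning
    nonFlat? : Decidable (λ X → ¬ Flat X 1 (flatDenominator m))
    nonFlat? X = ¬? (flat? X 1 (flatDenominator m))

  badCount*p^m≤ : ∀ n m → 3 * m ≤ n → badCount n m 1 (flatDenominator m) * p ^ m ≤ p ^ (n * m)
  badCount*p^m≤ n m 3m≤n = *-cancelʳ-≤ (bad * p ^ m) (p ^ (n * m)) (p ^ m * p ^ m) (begin
    bad * p ^ m * (p ^ m * p ^ m)    ≡⟨ *-assoc bad (p ^ m) _ ⟩
    bad * (p ^ m * (p ^ m * p ^ m))  ≡⟨ cong (bad *_) p^[3*m] ⟨
    bad * p ^ (3 * m)                ≤⟨ *-monoʳ-≤ bad (^-monoʳ-≤ p 3m≤n) ⟩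
    bad * p ^ n                      ≤⟨ badCount*p^n≤-union n m ⟩
    p ^ m * p ^ m * p ^ (n * m)      ≡⟨ *-comm (p ^ m * p ^ m) _ ⟩
    p ^ (n * m) * (p ^ m * p ^ m)    ∎)
    where
    open ≤-Reasoning
    bad : ℕ
    bad = badCount n m 1 (flatDenominator m)
    instance
      p^m≢0 : NonZero (p ^ m)
      p^m≢0 = m^n≢0 p m
      p^m*p^m≢0 : NonZero (p ^ m * p ^ m)
      p^m*p^m≢0 = m*n≢0 (p ^ m) (p ^ m)
    p^[3*m] : p ^ (3 * m) ≡ p ^ m * (p ^ m * p ^ m)
    p^[3*m] = begin-equality
      p ^ (m + (m + (m + 0)))   ≡⟨ cong (λ k → p ^ (m + (m + k))) (+-identityʳ m) ⟩
      p ^ (m + (m + m))         ≡⟨ ^-distribˡ-+-* p m (m + m) ⟩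
      p ^ m * p ^ (m + m)       ≡⟨ cong (p ^ m *_) (^-distribˡ-+-* p m m) ⟩
      p ^ m * (p ^ m * p ^ m)   ∎

lemma6p9 : (p n r m : ℕ) → (pp : Prime p) → (f : Vec (Fin p) n → Vec (Fin p) r) → 2 ∣ m → 4 * m ≤ n →
    Fp.badCount p {{prime⇒nonZero pp}} n m 1 ((m C (m / 2)) * (p ∸ 1) ^ (m / 2)) * p ^ m
      ≤ 2 * length (Fp.allX p {{prime⇒nonZero pp}} n m)
lemma6p9 p n r m pp _ _ 4m≤n = begin
  Fp.badCount p n m 1 ((m C (m / 2)) * (p ∸ 1) ^ (m / 2)) * p ^ m
    ≤⟨ badCount*p^m≤ p pp n m (≤-trans (*-monoˡ-≤ m (n≤1+n 3)) 4m≤n) ⟩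
  p ^ (n * m)
    ≤⟨ m≤m+n (p ^ (n * m)) (p ^ (n * m) + 0) ⟩
  2 * p ^ (n * m)
    ≡⟨ cong (2 *_) (length-allX p pp n m) ⟨
  2 * length (Fp.allX p n m) ∎
  where
  open ≤-Reasoning
  instance
    p≢0 : NonZero p
    p≢0 = prime⇒nonZero pp
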